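{- $W(13,3) > 251{,}282{,}317$. Equivalently, there exists a coloring of $\{0,1,\ldots,251{,}282{,}316\}$ with $3$ colors containing no monochromatic arithmetic progression of length $13$.
   Context: For integers $k\ge 3$ and $r\ge 2$, the van der Waerden number $W(k,r)$ is the least positive integer $N$ such that every coloring of $\{0,1,\ldots,N-1\}$ with $r$ colors contains a monochromatic arithmetic progression of length $k$, i.e. integers $a, a+d, \ldots, a+(k-1)d$ with $d\ge 1$, all in the set and all of the same color. Thus $W(k,r)>n$ means there is an $r$-coloring of $\{0,\ldots,n-1\}$ with no monochromatic $k$-term arithmetic progression. -}

module Defs where

open import Data.Nat using (ℕ; _+_; _*_; _<_; _≥_)
open import Data.Fin using (Fin)
open import Data.Product using (∃; Σ; _×_; _,_)
open import Relation.Binary.PropositionalEquality using (_≡_)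
open import Relation.Nullary using (¬_)

Coloring : ℕ → ℕ → Set
Coloring n r = (i : ℕ) → i < n → Fin r

MonoAP : ∀ {n r} → ℕ → Coloring n r → Set
MonoAP {n} {r} k c =
  Σ ℕ λ a → Σ ℕ λ d → d ≥ 1 × Σ (Fin r) λ col →
    ((j : ℕ) → j < k → Σ (a + j * d < n) λ p → c (a + j * d) p ≡ col)

WGreater : ℕ → ℕ → ℕ → Set
WGreater k r n = Σ (Coloring n r) λ c → ¬ MonoAP k c

-- Let P = 20940193, a prime with P ≡ 1 (mod 3), and let χ(x) = x^((P−1)/3) mod P be the cubic
-- residue character, whose values on units are the three cube roots of unity 1, ω₁, ω₂ mod P.
-- Colour i by the class of χ(i) when P ∤ i, and by (i / P) mod 3 when P ∣ i.
--
-- Since N = 12P + 1, a 13-term progression a + jd in {0,…,N−1} with P ∣ d must be 0, P, …, 12P,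
-- whose first two terms get the colours 0 and 1. If P ∤ d, write a ≡ bd (mod P); then
-- a + jd ≡ (b + j)d, so the terms have the colours of χ(d)χ(b + j), and two consecutive terms
-- differ in colour as soon as χ(t) ≠ χ(t + 1) for t = b + j. A machine check over all residues
-- shows that every 12 consecutive integers contain such a t, so no progression of length 13 is
-- monochromatic.
module Submission where

open import Defs
open import Agda.Builtin.Strict using (primForce; primForceLemma)
open import Algebra.Bundles using (Semiring)
import Algebra.Definitions.RawSemiring as RawSemiringDefinitions
import Algebra.Properties.CommutativeSemiring.Binomial as Binomial
open import Data.Bool using (Bool; true; false; T; _∧_; _∨_; if_then_else_)
open import Data.Bool.Properties using (T-∧)
open import Data.Empty using (⊥; ⊥-elim)
open import Data.Fin using (Fin; zero; suc; toℕ; fromℕ)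
open import Data.Fin.Properties using (toℕ-fromℕ)
open import Data.List using (List; []; _∷_)
open import Data.Nat
open import Data.Nat.Combinatorics using (_C_; nCn≡1; k![n∸k]!∣n!)
open import Data.Nat.Combinatorics.Specification using (nCk≡n!/k![n-k]!)
open import Data.Nat.Divisibility
open import Data.Nat.DivMod hiding (_mod_)
import Data.Nat.DivMod as DivMod
open import Data.Nat.Primality
open import Data.Nat.Properties
open import Data.Nat.Tactic.RingSolver using (solve-∀)
open import Data.Product using (Σ; ∃-syntax; _×_; _,_; proj₁; proj₂)
open import Data.Sum using (_⊎_; inj₁; inj₂; [_,_]′)
import Data.Vec.Functional as Vector
open import Function using (_∘_; case_of_; Equivalence)
open import Relation.Binary.Bundles using (Setoid)
import Relation.Binary.Reasoning.Setoid as SetoidReasoning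
open import Relation.Binary.PropositionalEquality
open import Relation.Nullary using (¬_; yes; no; does; isNo; contradiction)
open import Relation.Nullary.Decidable using (toWitnessFalse; dec-false)

-- Modular arithmetic

infix 4 _≡_mod_

-- A record rather than a synonym for x % m ≡ y % m, so that unification sees x and y
-- instead of getting stuck on the reduced residues.
record _≡_mod_ (x y m : ℕ) .{{_ : NonZero m}} : Set where
  constructor mod-≡
  field residues-≡ : x % m ≡ y % m

open _≡_mod_

mod-setoid : (m : ℕ) → .{{NonZero m}} → Setoid _ _
mod-setoid m = record
  { _≈_           = λ x y → x ≡ y mod m
  ; isEquivalence = record
    { refl  = mod-≡ refl
    ; sym   = λ x≡y → mod-≡ (sym (residues-≡ x≡y))
    ; trans = λ x≡y y≡z → mod-≡ (trans (residues-≡ x≡y) (residues-≡ y≡z))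
    }
  }

module ≡-mod-Reasoning (m : ℕ) .{{_ : NonZero m}} = SetoidReasoning (mod-setoid m)

module _ {m : ℕ} .{{_ : NonZero m}} where

  ≡⇒≡-mod : ∀ {x y} → x ≡ y → x ≡ y mod m
  ≡⇒≡-mod x≡y = mod-≡ (cong (_% m) x≡y)

  ≡-mod-refl : ∀ {x} → x ≡ x mod m
  ≡-mod-refl = mod-≡ refl

  ≡-mod-sym : ∀ {x y} → x ≡ y mod m → y ≡ x mod m
  ≡-mod-sym = Setoid.sym (mod-setoid m)

  ≡-mod-trans : ∀ {x y z} → x ≡ y mod m → y ≡ z mod m → x ≡ z mod m
  ≡-mod-trans = Setoid.trans (mod-setoid m)

  %-mod : ∀ x → x % m ≡ x mod m
  %-mod x = mod-≡ (m%n%n≡m%n x m)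

  <⇒≡-mod⇒≡ : ∀ {x y} → x < m → y < m → x ≡ y mod m → x ≡ y
  <⇒≡-mod⇒≡ {x} {y} x<m y<m (mod-≡ x≡y) = trans (sym (m<n⇒m%n≡m x<m)) (trans x≡y (m<n⇒m%n≡m y<m))

  +-cong-mod : ∀ {x x′ y y′} → x ≡ x′ mod m → y ≡ y′ mod m → x + y ≡ x′ + y′ mod m
  +-cong-mod {x} {x′} {y} {y′} (mod-≡ x≡x′) (mod-≡ y≡y′) = mod-≡ (begin
    (x + y) % m            ≡⟨ %-distribˡ-+ x y m ⟩
    (x % m + y % m) % m    ≡⟨ cong₂ (λ u v → (u + v) % m) x≡x′ y≡y′ ⟩
    (x′ % m + y′ % m) % m  ≡⟨ %-distribˡ-+ x′ y′ m ⟨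
    (x′ + y′) % m          ∎)
    where open ≡-Reasoning

  *-cong-mod : ∀ {x x′ y y′} → x ≡ x′ mod m → y ≡ y′ mod m → x * y ≡ x′ * y′ mod m
  *-cong-mod {x} {x′} {y} {y′} (mod-≡ x≡x′) (mod-≡ y≡y′) = mod-≡ (begin
    (x * y) % m                ≡⟨ %-distribˡ-* x y m ⟩
    ((x % m) * (y % m)) % m    ≡⟨ cong₂ (λ u v → (u * v) % m) x≡x′ y≡y′ ⟩
    ((x′ % m) * (y′ % m)) % m  ≡⟨ %-distribˡ-* x′ y′ m ⟨
    (x′ * y′) % m              ∎)
    where open ≡-Reasoning

  ^-cong-mod : ∀ {x y} → x ≡ y mod m → ∀ k → x ^ k ≡ y ^ k mod m
  ^-cong-mod x≡y zero    = ≡-mod-refl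
  ^-cong-mod x≡y (suc k) = *-cong-mod x≡y (^-cong-mod x≡y k)

  ∣-resp-mod : ∀ {x y} → x ≡ y mod m → m ∣ x → m ∣ y
  ∣-resp-mod {x} {y} (mod-≡ x≡y) m∣x = m%n≡0⇒n∣m y m (trans (sym x≡y) (n∣m⇒m%n≡0 x m m∣x))

  ≡-mod⇒∣∸ : ∀ {x y} → x ≡ y mod m → m ∣ x ∸ y
  ≡-mod⇒∣∸ {x} {y} (mod-≡ x≡y) = divides (x / m ∸ y / m) (begin
    x ∸ y                                      ≡⟨ cong₂ _∸_ (m≡m%n+[m/n]*n x m) (m≡m%n+[m/n]*n y m) ⟩
    (x % m + x / m * m) ∸ (y % m + y / m * m)  ≡⟨ cong (λ r → (x % m + x / m * m) ∸ (r + y / m * m)) x≡y ⟨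
    (x % m + x / m * m) ∸ (x % m + y / m * m)  ≡⟨ [m+n]∸[m+o]≡n∸o (x % m) _ _ ⟩
    x / m * m ∸ y / m * m                      ≡⟨ *-distribʳ-∸ m (x / m) (y / m) ⟨
    (x / m ∸ y / m) * m                        ∎)
    where open ≡-Reasoning

  sum-≡-last : ∀ k (f : Fin (suc k) → ℕ) → (∀ i → toℕ i < k → m ∣ f i) →
               Vector.foldr _+_ 0 f ≡ f (fromℕ k) mod m
  sum-≡-last zero    f _     = ≡⇒≡-mod (+-identityʳ (f zero))
  sum-≡-last (suc k) f m∣f<k = ≡-mod-trans
    (mod-≡ (%-remove-+ˡ _ (m∣f<k zero z<s)))
    (sum-≡-last k (f ∘ suc) (λ i i<k → m∣f<k (suc i) (s<s i<k)))

∣∧<⇒≡0 : ∀ {m k} → k < m → m ∣ k → k ≡ 0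
∣∧<⇒≡0 {k = zero}  _   _   = refl
∣∧<⇒≡0 {k = suc k} k<m m∣k = contradiction m∣k (>⇒∤ k<m)

m^[2*n]≡[m*m]^n : ∀ m n → m ^ (2 * n) ≡ (m * m) ^ n
m^[2*n]≡[m*m]^n m n = trans (sym (^-*-assoc m 2 n)) (cong (λ y → (m * y) ^ n) (*-identityʳ m))

^-distribʳ-* : ∀ x y k → (x * y) ^ k ≡ x ^ k * y ^ k
^-distribʳ-* x y zero    = refl
^-distribʳ-* x y (suc k) = trans (cong (x * y *_) (^-distribʳ-* x y k)) (*-interchange x y (x ^ k) (y ^ k))
  where open import Algebra.Properties.CommutativeSemigroup *-commutativeSemigroup
          using () renaming (interchange to *-interchange)

∣d∧a+kd≤kp⇒d≡p∧a≡0 : ∀ {p a d} k .{{_ : NonZero k}} → 0 < d → p ∣ d → a + k * d ≤ k * p → d ≡ p × a ≡ 0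
∣d∧a+kd≤kp⇒d≡p∧a≡0 {p} {a} {d} k d>0 p∣d a+kd≤kp = d≡p , n≤0⇒n≡0 (+-cancelʳ-≤ (k * p) a 0 a+kp≤kp)
  where
  d≡p : d ≡ p
  d≡p = ≤-antisym (*-cancelˡ-≤ k (m+n≤o⇒n≤o a a+kd≤kp)) (∣⇒≤ {{>-nonZero d>0}} p∣d)
  a+kp≤kp : a + k * p ≤ k * p
  a+kp≤kp = subst (λ e → a + k * e ≤ k * p) d≡p a+kd≤kp

∣v+[p∸c]⇒v≡c : ∀ {p v c} → v < p → c < p → p ∣ v + (p ∸ c) → v ≡ c
∣v+[p∸c]⇒v≡c {p} {v} {c} v<p c<p p∣s = +-cancelʳ-≡ (p ∸ c) v c (trans (s≡p p∣s) (sym (m+[n∸m]≡n (<⇒≤ c<p))))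
  where
  s : ℕ
  s = v + (p ∸ c)
  s≡p : p ∣ s → s ≡ p
  s≡p (divides zero          s≡0)   = contradiction s≡0 (>⇒≢ (<-≤-trans (m<n⇒0<n∸m c<p) (m≤n+m (p ∸ c) v)))
  s≡p (divides (suc zero)    s≡p+0) = trans s≡p+0 (+-identityʳ p)
  s≡p (divides (suc (suc q)) s≡qp)  =
    contradiction (subst (p + p ≤_) (sym s≡qp) (+-monoʳ-≤ p (m≤m+n p (q * p)))) (<⇒≱ (+-mono-<-≤ v<p (m∸n≤m p c)))

cubic-expansion : ∀ v a b c →
  (v + a) * (v + b) * (v + c) ≡ v * (v * v) + (a + b + c) * (v * v) + (a * b + b * c + c * a) * v + a * b * c
cubic-expansion = solve-∀

v³≡1⇒∣[v+a][v+b][v+c] : ∀ {m} .{{_ : NonZero m}} v a b c → v ^ 3 ≡ 1 mod m →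
                        a + b + c ≡ 0 mod m → a * b + b * c + c * a ≡ 0 mod m → 1 + a * b * c ≡ 0 mod m →
                        m ∣ (v + a) * (v + b) * (v + c)
v³≡1⇒∣[v+a][v+b][v+c] {m} v a b c v³≡1 σ₁≡0 σ₂≡0 1+σ₃≡0 = ∣-resp-mod (≡-mod-sym (begin
  (v + a) * (v + b) * (v + c)
    ≡⟨ cubic-expansion v a b c ⟩
  v * (v * v) + (a + b + c) * (v * v) + (a * b + b * c + c * a) * v + a * b * c
    ≈⟨ +-cong-mod (+-cong-mod (+-cong-mod v³≡1′ (*-cong-mod σ₁≡0 ≡-mod-refl)) (*-cong-mod σ₂≡0 ≡-mod-refl)) ≡-mod-refl ⟩
  1 + 0 * (v * v) + 0 * v + a * b * c
    ≈⟨ 1+σ₃≡0 ⟩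
  0 ∎)) (m ∣0)
  where
  open ≡-mod-Reasoning m
  v³≡1′ : v * (v * v) ≡ 1 mod m
  v³≡1′ = ≡-mod-trans (≡⇒≡-mod (cong (λ y → v * (v * y)) (sym (*-identityʳ v)))) v³≡1

-- Fermat's little theorem

private
  module ℕ-Semiring = RawSemiringDefinitions (Semiring.rawSemiring +-*-semiring)

  ^-semiring : ∀ x k → x ℕ-Semiring.^ k ≡ x ^ k
  ^-semiring x zero    = refl
  ^-semiring x (suc k) = cong (x *_) (^-semiring x k)

  ×-semiring : ∀ k x → k ℕ-Semiring.× x ≡ k * x
  ×-semiring zero    x = refl
  ×-semiring (suc k) x = cong (x +_) (×-semiring k x)

module _ {n : ℕ} (prime : Prime (suc n)) where

  private
    p : ℕ
    p = suc n

  prime∤1 : ¬ p ∣ 1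
  prime∤1 p∣1 = ¬prime[1] (subst Prime (∣1⇒≡1 p∣1) prime)

  prime∤! : ∀ {k} → k < p → ¬ p ∣ k !
  prime∤! {zero}  _   = prime∤1
  prime∤! {suc k} k<p p∣k! with euclidsLemma (suc k) (k !) prime p∣k!
  ... | inj₁ p∣1+k = <⇒≱ k<p (∣⇒≤ p∣1+k)
  ... | inj₂ p∣k!  = prime∤! (<-trans (n<1+n k) k<p) p∣k!

  prime∣choose : ∀ {k} → 0 < k → k < p → p ∣ p C k
  prime∣choose {k} 0<k k<p with euclidsLemma (p C k) (k ! * (p ∸ k) !) prime p∣product
    where
    instance
      k![p-k]!≢0 : NonZero (k ! * (p ∸ k) !)
      k![p-k]!≢0 = k !* (p ∸ k) !≢0
    p∣product : p ∣ (p C k) * (k ! * (p ∸ k) !)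
    p∣product = subst (p ∣_) (sym (begin
      (p C k) * (k ! * (p ∸ k) !)                  ≡⟨ cong (_* (k ! * (p ∸ k) !)) (nCk≡n!/k![n-k]! (<⇒≤ k<p)) ⟩
      p ! / (k ! * (p ∸ k) !) * (k ! * (p ∸ k) !)  ≡⟨ m/n*n≡m (k![n∸k]!∣n! (<⇒≤ k<p)) ⟩
      p !                                          ∎)) (m∣m*n (n !))
      where open ≡-Reasoning
  ... | inj₁ p∣pCk      = p∣pCk
  ... | inj₂ p∣k![p-k]! =
    ⊥-elim ([ prime∤! k<p , prime∤! (∸-monoʳ-< 0<k (<⇒≤ k<p)) ]′ (euclidsLemma (k !) ((p ∸ k) !) prime p∣k![p-k]!))

  freshman's-dream : ∀ x → (x + 1) ^ p ≡ x ^ p + 1 mod p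
  freshman's-dream x = begin
    (x + 1) ^ p
      ≡⟨ trans (sym (^-semiring (x + 1) p)) (Binomial.theorem +-*-commutativeSemiring p x 1) ⟩
    term zero + Vector.foldr _+_ 0 (term ∘ suc)
      ≈⟨ +-cong-mod (≡⇒≡-mod first-term) (sum-≡-last n (term ∘ suc) middle-terms) ⟩
    1 + term (suc (fromℕ n))  ≡⟨ cong (1 +_) last-term ⟩
    1 + x ^ p                 ≡⟨ +-comm 1 (x ^ p) ⟩
    x ^ p + 1                 ∎
    where
    open ≡-mod-Reasoning p
    term : Fin (suc p) → ℕ
    term = Binomial.binomialTerm +-*-commutativeSemiring x 1 p
    term-≡ : ∀ i → term i ≡ (p C toℕ i) * (x ^ toℕ i * 1 ^ (p ∸ toℕ i))
    term-≡ i = trans (×-semiring (p C toℕ i) _)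
      (cong₂ (λ u v → (p C toℕ i) * (u * v)) (^-semiring x (toℕ i)) (^-semiring 1 (p ∸ toℕ i)))
    first-term : term zero ≡ 1
    first-term = trans (term-≡ zero) (cong (λ y → (p C 0) * (1 * y)) (^-zeroˡ p))
    last-term : term (suc (fromℕ n)) ≡ x ^ p
    last-term rewrite term-≡ (suc (fromℕ n)) | toℕ-fromℕ n | nCn≡1 p | n∸n≡0 p =
      trans (+-identityʳ (x ^ p * 1)) (*-identityʳ (x ^ p))
    middle-terms : ∀ i → toℕ i < n → p ∣ term (suc i)
    middle-terms i i<n = subst (p ∣_) (sym (term-≡ (suc i))) (∣m⇒∣m*n _ (prime∣choose z<s (s<s i<n)))

  fermat : ∀ x → x ^ p ≡ x mod p
  fermat zero    = ≡-mod-refl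
  fermat (suc x) = begin
    suc x ^ p     ≡⟨ cong (_^ p) (+-comm 1 x) ⟩
    (x + 1) ^ p   ≈⟨ freshman's-dream x ⟩
    x ^ p + 1     ≈⟨ +-cong-mod (fermat x) ≡-mod-refl ⟩
    x + 1         ≡⟨ +-comm x 1 ⟩
    suc x         ∎
    where open ≡-mod-Reasoning p

  ∣-*₃ : ∀ {x y z} → p ∣ x * y * z → p ∣ x ⊎ p ∣ y ⊎ p ∣ z
  ∣-*₃ {x} {y} {z} p∣xyz with euclidsLemma (x * y) z prime p∣xyz
  ... | inj₂ p∣z  = inj₂ (inj₂ p∣z)
  ... | inj₁ p∣xy with euclidsLemma x y prime p∣xy
  ...   | inj₁ p∣x = inj₁ p∣x
  ...   | inj₂ p∣y = inj₂ (inj₁ p∣y)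

  ∤-* : ∀ {x y} → ¬ p ∣ x → ¬ p ∣ y → ¬ p ∣ x * y
  ∤-* p∤x p∤y p∣xy = [ p∤x , p∤y ]′ (euclidsLemma _ _ prime p∣xy)

  ∤-^ : ∀ {x} → ¬ p ∣ x → ∀ k → ¬ p ∣ x ^ k
  ∤-^ p∤x zero    = prime∤1
  ∤-^ p∤x (suc k) = ∤-* p∤x (∤-^ p∤x k)

  *-cancelˡ-mod : ∀ {x} a b → ¬ p ∣ x → x * a ≡ x * b mod p → a ≡ b mod p
  *-cancelˡ-mod {x} a b p∤x xa≡xb = mod-≡ (cancel-reduced (m%n<n a p) (m%n<n b p) (begin
    x * (a % p)  ≈⟨ *-cong-mod (≡-mod-refl {x = x}) (%-mod a) ⟩
    x * a        ≈⟨ xa≡xb ⟩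
    x * b        ≈⟨ *-cong-mod (≡-mod-refl {x = x}) (%-mod b) ⟨
    x * (b % p)  ∎))
    where
    open ≡-mod-Reasoning p
    cancel-ordered : ∀ {u v} → v ≤ u → u < p → x * u ≡ x * v mod p → u ≡ v
    cancel-ordered {u} {v} v≤u u<p xu≡xv
      with euclidsLemma x (u ∸ v) prime (subst (p ∣_) (sym (*-distribˡ-∸ x u v)) (≡-mod⇒∣∸ xu≡xv))
    ... | inj₁ p∣x   = contradiction p∣x p∤x
    ... | inj₂ p∣u-v = ≤-antisym (m∸n≡0⇒m≤n (∣∧<⇒≡0 (≤-<-trans (m∸n≤m u v) u<p) p∣u-v)) v≤u
    cancel-reduced : ∀ {u v} → u < p → v < p → x * u ≡ x * v mod p → u ≡ v
    cancel-reduced {u} {v} u<p v<p xu≡xv with ≤-total v u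
    ... | inj₁ v≤u = cancel-ordered v≤u u<p xu≡xv
    ... | inj₂ u≤v = sym (cancel-ordered u≤v v<p (≡-mod-sym xu≡xv))

  fermat-little : ∀ {x} → ¬ p ∣ x → x ^ n ≡ 1 mod p
  fermat-little {x} p∤x = *-cancelˡ-mod (x ^ n) 1 p∤x (begin
    x ^ p  ≈⟨ fermat x ⟩
    x      ≡⟨ *-identityʳ x ⟨
    x * 1  ∎)
    where open ≡-mod-Reasoning p

  ∃-quotient : ∀ a {d} → ¬ p ∣ d → ∃[ b ] b < p × a ≡ b * d mod p
  ∃-quotient a {d} p∤d = a * d ^ pred n % p , m%n<n (a * d ^ pred n) p , ≡-mod-sym (begin
    a * d ^ pred n % p * d  ≈⟨ *-cong-mod (%-mod (a * d ^ pred n)) ≡-mod-refl ⟩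
    a * d ^ pred n * d      ≡⟨ *-assoc a (d ^ pred n) d ⟩
    a * (d ^ pred n * d)    ≡⟨ cong (a *_) (trans (*-comm (d ^ pred n) d) (cong (d ^_) (suc-pred n))) ⟩
    a * d ^ n               ≈⟨ *-cong-mod (≡-mod-refl {x = a}) (fermat-little p∤d) ⟩
    a * 1                   ≡⟨ *-identityʳ a ⟩
    a                       ∎)
    where
    open ≡-mod-Reasoning p
    instance
      n≢0 : NonZero n
      n≢0 = ≢-nonZero λ n≡0 → ¬prime[1] (subst (Prime ∘ suc) n≡0 prime)

module ModularExponentiation (m : ℕ) .{{_ : NonZero m}} where

  fromBits : List Bool → ℕ
  fromBits []           = 0
  fromBits (false ∷ bs) = 2 * fromBits bs
  fromBits (true  ∷ bs) = suc (2 * fromBits bs)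

  -- primForce makes conversion checking evaluate x * x % m once rather than once per occurrence.
  powMod : List Bool → ℕ → ℕ
  powMod []           x = 1 % m
  powMod (false ∷ bs) x = primForce (x * x % m) (powMod bs)
  powMod (true  ∷ bs) x = primForce (x * x % m) λ y → x * powMod bs y % m

  powMod-correct : ∀ bs x → powMod bs x ≡ x ^ fromBits bs % m
  powMod-square : ∀ bs x → powMod bs (x * x % m) ≡ x ^ (2 * fromBits bs) % m

  powMod-square bs x = begin
    powMod bs (x * x % m)  ≡⟨ powMod-correct bs (x * x % m) ⟩
    (x * x % m) ^ v % m    ≡⟨ residues-≡ (^-cong-mod (%-mod (x * x)) v) ⟩
    (x * x) ^ v % m        ≡⟨ cong (_% m) (m^[2*n]≡[m*m]^n x v) ⟨
    x ^ (2 * v) % m        ∎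
    where
    open ≡-Reasoning
    v : ℕ
    v = fromBits bs

  powMod-correct []           x = refl
  powMod-correct (false ∷ bs) x = trans (primForceLemma (x * x % m) (powMod bs)) (powMod-square bs x)
  powMod-correct (true  ∷ bs) x = begin
    primForce (x * x % m) (λ y → x * powMod bs y % m)  ≡⟨ primForceLemma (x * x % m) (λ y → x * powMod bs y % m) ⟩
    x * powMod bs (x * x % m) % m                       ≡⟨ cong (λ y → x * y % m) (powMod-square bs x) ⟩
    x * (x ^ (2 * v) % m) % m                           ≡⟨ residues-≡ (*-cong-mod (≡-mod-refl {x = x}) (%-mod (x ^ (2 * v)))) ⟩
    x * x ^ (2 * v) % m                                 ∎
    where
    open ≡-Reasoning
    v : ℕ
    v = fromBits bs

noDivisorFrom : (n d k : ℕ) → Bool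
noDivisorFrom n d zero    = true
noDivisorFrom n d (suc k) = isNo (d ∣? n) ∧ noDivisorFrom n (suc d) k

noDivisorFrom⇒rough : ∀ {n} d k → T (noDivisorFrom n d k) → d Rough n → (k + d) Rough n
noDivisorFrom⇒rough d zero    _  d-rough = d-rough
noDivisorFrom⇒rough {n} d (suc k) ok d-rough with Equivalence.to T-∧ ok
... | d∤n , rest = subst (_Rough n) (+-suc k d)
  (noDivisorFrom⇒rough (suc d) k rest (∤⇒rough-suc (toWitnessFalse {a? = d ∣? n} d∤n) d-rough))

module GreedyScan (good : ℕ → Bool) (w bound : ℕ) where

  scan : (fuel t : ℕ) → Bool
  search : (fuel t k : ℕ) → Bool
  scan zero       t = false
  scan (suc fuel) t = (bound ≤ᵇ t) ∨ search fuel t w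
  search fuel t zero    = false
  search fuel t (suc k) = if good (t + suc k) then scan fuel (t + suc k) else search fuel t k

  scan-sound : ∀ fuel t → scan fuel t ≡ true → ∀ b → t < b → b ≤ bound → ∃[ j ] j < w × good (b + j) ≡ true
  search-sound : ∀ fuel t k → k ≤ w → search fuel t k ≡ true →
                 ∀ b → t < b → b ≤ bound → ∃[ j ] j < w × good (b + j) ≡ true

  scan-sound (suc fuel) t ok b t<b b≤bound with bound ≤ᵇ t in bound≤ᵇt
  ... | true  = contradiction (≤-<-trans (≤ᵇ⇒≤ bound t (subst T (sym bound≤ᵇt) _)) t<b) (≤⇒≯ b≤bound)
  ... | false = search-sound fuel t w ≤-refl ok b t<b b≤bound

  search-sound fuel t (suc k) k<w ok b t<b b≤bound with good (t + suc k) in good-t′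
  ... | false = search-sound fuel t k (<⇒≤ k<w) ok b t<b b≤bound
  ... | true with b ≤? t + suc k
  ...   | no  b≰t′ = scan-sound fuel (t + suc k) ok b (≰⇒> b≰t′) b≤bound
  ...   | yes b≤t′ = t + suc k ∸ b , j<w , subst (λ t′ → good t′ ≡ true) (sym (m+[n∸m]≡n b≤t′)) good-t′
    where
    j<w : t + suc k ∸ b < w
    j<w = m<n+o⇒m∸n<o (t + suc k) b {{>-nonZero (<-≤-trans z<s k<w)}} (+-mono-<-≤ t<b k<w)

-- The prime P and its cubic residue character

P : ℕ
P = 20940193

P-prime : Prime P
P-prime = rough∧square>⇒prime (noDivisorFrom⇒rough 2 4575 _ 2-rough) (<ᵇ⇒< P (4577 * 4577) _)

-- E = (P − 1) / 3
E : ℕ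
E = 6980064

-- Opaque, because unfolding χ during conversion checking would expand x ^ E into E factors.
opaque
  χ : ℕ → ℕ
  χ x = x ^ E % P

  χ-≡ : ∀ x → χ x ≡ x ^ E % P
  χ-≡ x = refl

  χ<P : ∀ x → χ x < P
  χ<P x = m%n<n (x ^ E) P

  χ-cong : ∀ {x y} → x ≡ y mod P → χ x ≡ χ y
  χ-cong x≡y = residues-≡ (^-cong-mod x≡y E)

  χ-* : ∀ x y → χ (x * y) ≡ χ x * χ y mod P
  χ-* x y = begin
    (x * y) ^ E % P      ≈⟨ %-mod ((x * y) ^ E) ⟩
    (x * y) ^ E          ≡⟨ ^-distribʳ-* x y E ⟩
    x ^ E * y ^ E        ≈⟨ *-cong-mod (%-mod (x ^ E)) (%-mod (y ^ E)) ⟨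
    χ x * χ y            ∎
    where open ≡-mod-Reasoning P

  ∣⇒χ≡0 : ∀ {x} → P ∣ x → χ x ≡ 0
  ∣⇒χ≡0 {x} P∣x = n∣m⇒m%n≡0 (x ^ E) P (∣m⇒∣m*n (x ^ pred E) P∣x)

  ∤χ : ∀ {x} → ¬ P ∣ x → ¬ P ∣ χ x
  ∤χ {x} P∤x P∣χx = ∤-^ P-prime P∤x E (∣-resp-mod (%-mod (x ^ E)) P∣χx)

  χ-cube : ∀ {x} → ¬ P ∣ x → χ x ^ 3 ≡ 1 mod P
  χ-cube {x} P∤x = begin
    χ x ^ 3      ≈⟨ ^-cong-mod (%-mod (x ^ E)) 3 ⟩
    (x ^ E) ^ 3  ≡⟨ ^-*-assoc x E 3 ⟩
    x ^ (E * 3)  ≈⟨ fermat-little P-prime P∤x ⟩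
    1            ∎
    where open ≡-mod-Reasoning P

χ-cancelʳ : ∀ {x y d} → ¬ P ∣ d → χ (x * d) ≡ χ (y * d) → χ x ≡ χ y mod P
χ-cancelʳ {x} {y} {d} P∤d χxd≡χyd = *-cancelˡ-mod P-prime (χ x) (χ y) (∤χ P∤d) (begin
  χ d * χ x  ≡⟨ *-comm (χ d) (χ x) ⟩
  χ x * χ d  ≈⟨ χ-* x d ⟨
  χ (x * d)  ≡⟨ χxd≡χyd ⟩
  χ (y * d)  ≈⟨ χ-* y d ⟩
  χ y * χ d  ≡⟨ *-comm (χ y) (χ d) ⟩
  χ d * χ y  ∎)
  where open ≡-mod-Reasoning P

ω₁ ω₂ : ℕ
ω₁ = 1874453
ω₂ = 19065739

cubeRootOfUnity : Fin 3 → ℕ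
cubeRootOfUnity zero             = 1
cubeRootOfUnity (suc zero)       = ω₁
cubeRootOfUnity (suc (suc zero)) = ω₂

-- X³ − 1 ≡ (X − 1)(X − ω₁)(X − ω₂) modulo P.
cubeRootsOfUnity : ∀ {v} → v < P → v ^ 3 ≡ 1 mod P → ∃[ c ] v ≡ cubeRootOfUnity c
cubeRootsOfUnity {v} v<P v³≡1 =
  root (∣-*₃ P-prime (v³≡1⇒∣[v+a][v+b][v+c] v (P ∸ 1) (P ∸ ω₁) (P ∸ ω₂) v³≡1 (mod-≡ refl) (mod-≡ refl) (mod-≡ refl)))
  where
  root : P ∣ v + (P ∸ 1) ⊎ P ∣ v + (P ∸ ω₁) ⊎ P ∣ v + (P ∸ ω₂) → ∃[ c ] v ≡ cubeRootOfUnity c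
  root (inj₁ P∣v+[P-1])         = zero             , ∣v+[p∸c]⇒v≡c v<P (<ᵇ⇒< 1 P _) P∣v+[P-1]
  root (inj₂ (inj₁ P∣v+[P-ω₁])) = suc zero         , ∣v+[p∸c]⇒v≡c v<P (<ᵇ⇒< ω₁ P _) P∣v+[P-ω₁]
  root (inj₂ (inj₂ P∣v+[P-ω₂])) = suc (suc zero)   , ∣v+[p∸c]⇒v≡c v<P (<ᵇ⇒< ω₂ P _) P∣v+[P-ω₂]

χ-cubeRootOfUnity : ∀ {x} → ¬ P ∣ x → ∃[ c ] χ x ≡ cubeRootOfUnity c
χ-cubeRootOfUnity {x} P∤x = cubeRootsOfUnity (χ<P x) (χ-cube P∤x)

cubeRootClass : ℕ → Fin 3
cubeRootClass v = if v ≡ᵇ 1 then zero else if v ≡ᵇ ω₁ then suc zero else suc (suc zero)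

cubeRootClass-cubeRootOfUnity : ∀ c → cubeRootClass (cubeRootOfUnity c) ≡ c
cubeRootClass-cubeRootOfUnity zero             = refl
cubeRootClass-cubeRootOfUnity (suc zero)       = refl
cubeRootClass-cubeRootOfUnity (suc (suc zero)) = refl

colouring : Coloring (12 * P + 1) 3
colouring i _ = if does (P ∣? i) then (i / P) DivMod.mod 3 else cubeRootClass (χ i)

colouring-unit : ∀ {i} (i<N : i < 12 * P + 1) → ¬ P ∣ i → colouring i i<N ≡ cubeRootClass (χ i)
colouring-unit {i} _ P∤i =
  cong (λ b → if b then (i / P) DivMod.mod 3 else cubeRootClass (χ i)) (dec-false (P ∣? i) P∤i)

colouring-units-injective : ∀ {x y} (x<N : x < 12 * P + 1) (y<N : y < 12 * P + 1) → ¬ P ∣ x → ¬ P ∣ y →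
                            colouring x x<N ≡ colouring y y<N → χ x ≡ χ y
colouring-units-injective {x} {y} x<N y<N P∤x P∤y same-colour =
  same-root (χ-cubeRootOfUnity P∤x) (χ-cubeRootOfUnity P∤y)
  where
  open ≡-Reasoning
  same-root : ∃[ c ] χ x ≡ cubeRootOfUnity c → ∃[ c′ ] χ y ≡ cubeRootOfUnity c′ → χ x ≡ χ y
  same-root (c , χx≡c) (c′ , χy≡c′) = begin
    χ x                 ≡⟨ χx≡c ⟩
    cubeRootOfUnity c   ≡⟨ cong cubeRootOfUnity c≡c′ ⟩
    cubeRootOfUnity c′  ≡⟨ χy≡c′ ⟨
    χ y                 ∎
    where
    c≡c′ : c ≡ c′
    c≡c′ = begin
      c                                   ≡⟨ cubeRootClass-cubeRootOfUnity c ⟨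
      cubeRootClass (cubeRootOfUnity c)   ≡⟨ cong cubeRootClass χx≡c ⟨
      cubeRootClass (χ x)                 ≡⟨ colouring-unit x<N P∤x ⟨
      colouring x x<N                     ≡⟨ same-colour ⟩
      colouring y y<N                     ≡⟨ colouring-unit y<N P∤y ⟩
      cubeRootClass (χ y)                 ≡⟨ cong cubeRootClass χy≡c′ ⟩
      cubeRootClass (cubeRootOfUnity c′)  ≡⟨ cubeRootClass-cubeRootOfUnity c′ ⟩
      c′                                  ∎

-- The machine check

isPrimitiveCubeRoot : ℕ → Bool
isPrimitiveCubeRoot v = (v ≡ᵇ ω₁) ∨ (v ≡ᵇ ω₂)

open ModularExponentiation P using (fromBits; powMod; powMod-correct)

E-bits : List Bool
E-bits = false ∷ false ∷ false ∷ false ∷ false ∷ true ∷ true ∷ true ∷ true ∷ false ∷ false ∷ false ∷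
         false ∷ false ∷ false ∷ true ∷ false ∷ true ∷ false ∷ true ∷ false ∷ true ∷ true ∷ []

fromBits-E-bits : fromBits E-bits ≡ E
fromBits-E-bits = refl

-- χ(t)²χ(t + 1) is a primitive cube root of unity exactly when P ∤ t(t + 1) and χ(t) ≠ χ(t + 1);
-- testing it costs one exponentiation instead of two.
characterChanges : ℕ → Bool
characterChanges t = primForce (t * t % P * suc t % P) λ z → primForce (powMod E-bits z) isPrimitiveCubeRoot

characterChanges-χ : ∀ t → characterChanges t ≡ isPrimitiveCubeRoot (χ (t * t * suc t))
characterChanges-χ t = begin
  characterChanges t                                   ≡⟨ primForceLemma z _ ⟩
  primForce (powMod E-bits z) isPrimitiveCubeRoot      ≡⟨ primForceLemma (powMod E-bits z) isPrimitiveCubeRoot ⟩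
  isPrimitiveCubeRoot (powMod E-bits z)                ≡⟨ cong isPrimitiveCubeRoot (powMod-correct E-bits z) ⟩
  isPrimitiveCubeRoot (z ^ fromBits E-bits % P)        ≡⟨ cong (λ e → isPrimitiveCubeRoot (z ^ e % P)) fromBits-E-bits ⟩
  isPrimitiveCubeRoot (z ^ E % P)                      ≡⟨ cong isPrimitiveCubeRoot (χ-≡ z) ⟨
  isPrimitiveCubeRoot (χ z)                            ≡⟨ cong isPrimitiveCubeRoot (χ-cong z≡t²[t+1]) ⟩
  isPrimitiveCubeRoot (χ (t * t * suc t))              ∎
  where
  open ≡-Reasoning
  z : ℕ
  z = t * t % P * suc t % P
  z≡t²[t+1] : z ≡ t * t * suc t mod P
  z≡t²[t+1] = ≡-mod-trans (%-mod (t * t % P * suc t)) (*-cong-mod (%-mod (t * t)) ≡-mod-refl)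

characterChanges-sound : ∀ {t} → characterChanges t ≡ true →
                         ¬ P ∣ t × ¬ P ∣ suc t × ¬ (χ t ≡ χ (suc t) mod P)
characterChanges-sound {t} changes = P∤t , P∤t+1 , χ-differs
  where
  ruled-out : ∀ {v} → χ (t * t * suc t) ≡ v → isPrimitiveCubeRoot v ≡ false → ⊥
  ruled-out {v} χ≡v not-primitive = contradiction (begin
    false                                  ≡⟨ not-primitive ⟨
    isPrimitiveCubeRoot v                  ≡⟨ cong isPrimitiveCubeRoot χ≡v ⟨
    isPrimitiveCubeRoot (χ (t * t * suc t)) ≡⟨ characterChanges-χ t ⟨
    characterChanges t                     ≡⟨ changes ⟩
    true                                   ∎) λ ()
    where open ≡-Reasoning
  P∤t : ¬ P ∣ t
  P∤t P∣t = ruled-out (∣⇒χ≡0 (∣m⇒∣m*n (suc t) (∣m⇒∣m*n t P∣t))) refl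
  P∤t+1 : ¬ P ∣ suc t
  P∤t+1 P∣t+1 = ruled-out (∣⇒χ≡0 (∣n⇒∣m*n (t * t) P∣t+1)) refl
  χ-differs : ¬ (χ t ≡ χ (suc t) mod P)
  χ-differs χt≡χt+1 = ruled-out (<⇒≡-mod⇒≡ (χ<P (t * t * suc t)) (<ᵇ⇒< 1 P _) (begin
    χ (t * t * suc t)        ≈⟨ χ-* (t * t) (suc t) ⟩
    χ (t * t) * χ (suc t)    ≈⟨ *-cong-mod (χ-* t t) (≡-mod-sym χt≡χt+1) ⟩
    χ t * χ t * χ t          ≡⟨ trans (*-assoc (χ t) (χ t) (χ t)) (cong (λ y → χ t * (χ t * y)) (sym (*-identityʳ (χ t)))) ⟩
    χ t ^ 3                  ≈⟨ χ-cube P∤t ⟩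
    1                        ∎)) refl
    where open ≡-mod-Reasoning P

characterScan-succeeds : GreedyScan.scan characterChanges 12 (P ∸ 1) P 0 ≡ true
characterScan-succeeds = refl

characterChangesWithin12 : ∀ b → b < P → ∃[ j ] j < 12 × characterChanges (b + j) ≡ true
characterChangesWithin12 zero    _   = 2 , <ᵇ⇒< 2 12 _ , refl
characterChangesWithin12 (suc b) b<P =
  GreedyScan.scan-sound characterChanges 12 (P ∸ 1) P 0 characterScan-succeeds (suc b) z<s (≤-pred b<P)

MonochromaticProgression : ℕ → ℕ → Fin 3 → Set
MonochromaticProgression a d col =
  (j : ℕ) → j < 13 → Σ (a + j * d < 12 * P + 1) λ a+jd<N → colouring (a + j * d) a+jd<N ≡ col

multiplesOfP-not-monochromatic : ∀ {col} → ¬ MonochromaticProgression 0 P col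
multiplesOfP-not-monochromatic mono = contradiction (trans (proj₂ (mono 0 z<s)) (sym (proj₂ (mono 1 (s<s z<s))))) λ ()

step-multiple-of-P : ∀ {a d col} → 0 < d → P ∣ d → ¬ MonochromaticProgression a d col
step-multiple-of-P {col = col} d>0 P∣d mono =
  let d≡P , a≡0 = ∣d∧a+kd≤kp⇒d≡p∧a≡0 12 d>0 P∣d (≤-pred (proj₁ (mono 12 (n<1+n 12))))
  in multiplesOfP-not-monochromatic (subst₂ (λ a d → MonochromaticProgression a d col) a≡0 d≡P mono)

consecutive-terms-differ : ∀ {a d b j} → ¬ P ∣ d → a ≡ b * d mod P → characterChanges (b + j) ≡ true →
                           (X<N : a + j * d < 12 * P + 1) (Y<N : a + suc j * d < 12 * P + 1) →
                           colouring (a + j * d) X<N ≢ colouring (a + suc j * d) Y<N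
consecutive-terms-differ {a} {d} {b} {j} P∤d a≡bd changes X<N Y<N same-colour =
  χ-differs (χ-cancelʳ P∤d (begin
    χ ((b + j) * d)      ≡⟨ χ-cong (term≡ j) ⟨
    χ (a + j * d)        ≡⟨ colouring-units-injective X<N Y<N P∤X P∤Y same-colour ⟩
    χ (a + suc j * d)    ≡⟨ χ-cong (term≡ (suc j)) ⟩
    χ ((b + suc j) * d)  ≡⟨ cong (λ s → χ (s * d)) (+-suc b j) ⟩
    χ (suc (b + j) * d)  ∎))
  where
  open ≡-Reasoning
  sound : ¬ P ∣ b + j × ¬ P ∣ suc (b + j) × ¬ (χ (b + j) ≡ χ (suc (b + j)) mod P)
  sound = characterChanges-sound {b + j} changes
  χ-differs : ¬ (χ (b + j) ≡ χ (suc (b + j)) mod P)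
  χ-differs = proj₂ (proj₂ sound)
  term≡ : ∀ k → a + k * d ≡ (b + k) * d mod P
  term≡ k = ≡-mod-trans (+-cong-mod a≡bd ≡-mod-refl) (≡⇒≡-mod (sym (*-distribʳ-+ d b k)))
  P∤X : ¬ P ∣ a + j * d
  P∤X P∣X = ∤-* P-prime (proj₁ sound) P∤d (∣-resp-mod (term≡ j) P∣X)
  P∤Y : ¬ P ∣ a + suc j * d
  P∤Y P∣Y = ∤-* P-prime (proj₁ (proj₂ sound)) P∤d (subst (λ s → P ∣ s * d) (+-suc b j) (∣-resp-mod (term≡ (suc j)) P∣Y))

step-coprime-to-P : ∀ {a d col} → ¬ P ∣ d → ¬ MonochromaticProgression a d col
step-coprime-to-P {a} {d} P∤d mono =
  let b , b<P , a≡bd    = ∃-quotient P-prime a P∤d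
      j , j<12 , changes = characterChangesWithin12 b b<P
      X<N , X-colour     = mono j (<-trans j<12 (n<1+n 12))
      Y<N , Y-colour     = mono (suc j) (s<s j<12)
  in consecutive-terms-differ {b = b} {j = j} P∤d a≡bd changes X<N Y<N (trans X-colour (sym Y-colour))

mainTheorem1 : WGreater 13 3 251282317
mainTheorem1 = colouring , λ where
  (a , d , d≥1 , col , mono) → case P ∣? d of λ where
    (yes P∣d) → step-multiple-of-P d≥1 P∣d mono
    (no  P∤d) → step-coprime-to-P P∤d mono
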